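{- Every finite coproduct-finite product rig category is a finite coproduct-copy discard rig category (with the comonoids given by its finite product structure).
   Context: Composition is diagrammatic. A rig category has symmetric monoidal structures $(\otimes,1)$ and $(\oplus,0)$ with natural isomorphisms $\delta^l_{X,Y,Z}\colon X\otimes(Y\oplus Z)\to(X\otimes Y)\oplus(X\otimes Z)$, $\delta^r_{X,Y,Z}\colon(X\oplus Y)\otimes Z\to(X\otimes Z)\oplus(Y\otimes Z)$, $\lambda^\bullet_X\colon0\otimes X\to0$, $\rho^\bullet_X\colon X\otimes0\to0$ satisfying Laplaza's coherence axioms; $\lambda^\oplus,\rho^\oplus$ denote the unitors of $\oplus$. An fc category is a symmetric monoidal $(\mathcal{C},\oplus,0)$ with natural coherent commutative monoids $(\nabla_X\colon X\oplus X\to X, ¡_X\colon 0\to X)$ (i.e. $\oplus$ is a coproduct, $0$ initial). A cd category is a symmetric monoidal $(\mathcal{C},\otimes,1)$ with cocommutative comonoids $(\mathrm{copy}_X\colon X\to X\otimes X,\mathrm{disc}_X\colon X\to1)$ coherent with $\otimes$ ($\mathrm{copy}_{X\otimes Y}$ is $\mathrm{copy}_X\otimes\mathrm{copy}_Y$ followed by the middle interchange, $\mathrm{disc}_{X\otimes Y}=(\mathrm{disc}_X\otimes\mathrm{disc}_Y);\lambda_1$, $\mathrm{copy}_1=\lambda_1^{ -1}$, $\mathrm{disc}_1=\mathrm{id}_1$); an fp category is a cd category whose comonoids are natural. An fc-fp rig category is a rig category whose $\oplus$-part is fc and whose $\otimes$-part is fp. An fc-cd rig category is a rig category with monoids and comonoids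 such that the $\oplus$-part is fc, the $\otimes$-part is cd, and for all $X,Y$: $\mathrm{disc}_{X\oplus Y}=(\mathrm{disc}_X\oplus\mathrm{disc}_Y);\nabla_1$ and $\mathrm{copy}_{X\oplus Y}=((\rho^\oplus_X)^{ -1}\oplus(\lambda^\oplus_Y)^{ -1});((\mathrm{copy}_X\oplus ¡_{X\otimes Y})\oplus(¡_{Y\otimes X}\oplus\mathrm{copy}_Y));((\delta^l_{X,X,Y})^{ -1}\oplus(\delta^l_{Y,X,Y})^{ -1});(\delta^r_{X,Y,X\oplus Y})^{ -1}$. -}

module Defs where

open import Level using (Level; _⊔_) renaming (suc to lsuc)
open import Relation.Binary using (Rel; IsEquivalence)
open import Data.Product using (_×_)

-- Categories with setoid hom-sets; composition is DIAGRAMMATIC: f ⨾ g = "f then g".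
record Category (o ℓ e : Level) : Set (lsuc (o ⊔ ℓ ⊔ e)) where
  infixr 9 _⨾_
  infix  4 _≈_
  infix  5 _⇒_
  field
    Obj  : Set o
    _⇒_  : Obj → Obj → Set ℓ
    _≈_  : ∀ {A B} → Rel (A ⇒ B) e
    id   : ∀ {A} → A ⇒ A
    _⨾_  : ∀ {A B C} → A ⇒ B → B ⇒ C → A ⇒ C
    ≈-equiv   : ∀ {A B} → IsEquivalence (_≈_ {A} {B})
    ⨾-cong    : ∀ {A B C} {f f′ : A ⇒ B} {g g′ : B ⇒ C} → f ≈ f′ → g ≈ g′ → f ⨾ g ≈ f′ ⨾ g′
    identityˡ : ∀ {A B} {f : A ⇒ B} → id ⨾ f ≈ f
    identityʳ : ∀ {A B} {f : A ⇒ B} → f ⨾ id ≈ f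
    assoc     : ∀ {A B C D} {f : A ⇒ B} {g : B ⇒ C} {h : C ⇒ D} → (f ⨾ g) ⨾ h ≈ f ⨾ (g ⨾ h)

  Inverse : ∀ {A B} → A ⇒ B → B ⇒ A → Set e
  Inverse f g = (f ⨾ g ≈ id) × (g ⨾ f ≈ id)

record Monoidal {o ℓ e} (C : Category o ℓ e) : Set (o ⊔ ℓ ⊔ e) where
  open Category C
  infixr 10 _⊛_ _⊛₁_
  field
    _⊛_  : Obj → Obj → Obj
    _⊛₁_ : ∀ {A B C D} → A ⇒ B → C ⇒ D → (A ⊛ C) ⇒ (B ⊛ D)
    I    : Obj
    ⊛-id   : ∀ {A B} → id {A} ⊛₁ id {B} ≈ id
    ⊛-⨾    : ∀ {A B C D E F} {f : A ⇒ B} {g : B ⇒ C} {h : D ⇒ E} {k : E ⇒ F}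
             → (f ⨾ g) ⊛₁ (h ⨾ k) ≈ (f ⊛₁ h) ⨾ (g ⊛₁ k)
    ⊛-cong : ∀ {A B C D} {f f′ : A ⇒ B} {g g′ : C ⇒ D} → f ≈ f′ → g ≈ g′ → f ⊛₁ g ≈ f′ ⊛₁ g′
    α    : ∀ {A B C} → ((A ⊛ B) ⊛ C) ⇒ (A ⊛ (B ⊛ C))
    α⁻¹  : ∀ {A B C} → (A ⊛ (B ⊛ C)) ⇒ ((A ⊛ B) ⊛ C)
    λu   : ∀ {A} → (I ⊛ A) ⇒ A
    λu⁻¹ : ∀ {A} → A ⇒ (I ⊛ A)
    ρu   : ∀ {A} → (A ⊛ I) ⇒ A
    ρu⁻¹ : ∀ {A} → A ⇒ (A ⊛ I)
    α-iso  : ∀ {A B C} → Inverse (α {A} {B} {C}) α⁻¹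
    λu-iso : ∀ {A} → Inverse (λu {A}) λu⁻¹
    ρu-iso : ∀ {A} → Inverse (ρu {A}) ρu⁻¹
    α-nat  : ∀ {A A′ B B′ C C′} {f : A ⇒ A′} {g : B ⇒ B′} {h : C ⇒ C′}
             → ((f ⊛₁ g) ⊛₁ h) ⨾ α ≈ α ⨾ (f ⊛₁ (g ⊛₁ h))
    λu-nat : ∀ {A B} {f : A ⇒ B} → (id {I} ⊛₁ f) ⨾ λu ≈ λu ⨾ f
    ρu-nat : ∀ {A B} {f : A ⇒ B} → (f ⊛₁ id {I}) ⨾ ρu ≈ ρu ⨾ f
    pentagon : ∀ {A B C D} → (α {A} {B} {C} ⊛₁ id {D}) ⨾ α ⨾ (id ⊛₁ α) ≈ α ⨾ α
    triangle : ∀ {A B} → α {A} {I} {B} ⨾ (id ⊛₁ λu) ≈ ρu ⊛₁ id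

record SymMonoidal {o ℓ e} (C : Category o ℓ e) : Set (o ⊔ ℓ ⊔ e) where
  open Category C
  field
    monoidal : Monoidal C
  open Monoidal monoidal public
  field
    σ        : ∀ {A B} → (A ⊛ B) ⇒ (B ⊛ A)
    σ-nat    : ∀ {A A′ B B′} {f : A ⇒ A′} {g : B ⇒ B′} → (f ⊛₁ g) ⨾ σ ≈ σ ⨾ (g ⊛₁ f)
    σ-invol  : ∀ {A B} → σ {A} {B} ⨾ σ ≈ id
    hexagon  : ∀ {A B C} → α {A} {B} {C} ⨾ σ ⨾ α ≈ (σ ⊛₁ id) ⨾ α ⨾ (id ⊛₁ σ)

  interchange : ∀ {A B C D} → ((A ⊛ B) ⊛ (C ⊛ D)) ⇒ ((A ⊛ C) ⊛ (B ⊛ D))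
  interchange = α ⨾ (id ⊛₁ (α⁻¹ ⨾ (σ ⊛₁ id) ⨾ α)) ⨾ α⁻¹

record FC {o ℓ e} {C : Category o ℓ e} (S : SymMonoidal C) : Set (o ⊔ ℓ ⊔ e) where
  open Category C
  open SymMonoidal S
  field
    ∇ : ∀ {X} → (X ⊛ X) ⇒ X
    ¡ : ∀ {X} → I ⇒ X
    ∇-assoc : ∀ {X} → (∇ ⊛₁ id) ⨾ ∇ ≈ α {X} {X} {X} ⨾ (id ⊛₁ ∇) ⨾ ∇
    ∇-unitˡ : ∀ {X} → (¡ ⊛₁ id) ⨾ ∇ ≈ λu {X}
    ∇-unitʳ : ∀ {X} → (id ⊛₁ ¡) ⨾ ∇ ≈ ρu {X}
    ∇-comm  : ∀ {X} → σ {X} {X} ⨾ ∇ ≈ ∇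
    ∇-⊛     : ∀ {X Y} → ∇ {X ⊛ Y} ≈ interchange ⨾ (∇ ⊛₁ ∇)
    ¡-⊛     : ∀ {X Y} → ¡ {X ⊛ Y} ≈ λu⁻¹ ⨾ (¡ ⊛₁ ¡)
    ∇-I     : ∇ {I} ≈ λu
    ¡-I     : ¡ {I} ≈ id
    ∇-nat   : ∀ {X Y} {f : X ⇒ Y} → (f ⊛₁ f) ⨾ ∇ ≈ ∇ ⨾ f
    ¡-nat   : ∀ {X Y} {f : X ⇒ Y} → ¡ ⨾ f ≈ ¡

record CD {o ℓ e} {C : Category o ℓ e} (S : SymMonoidal C) : Set (o ⊔ ℓ ⊔ e) where
  open Category C
  open SymMonoidal S
  field
    copy : ∀ {X} → X ⇒ (X ⊛ X)
    disc : ∀ {X} → X ⇒ I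
    copy-assoc : ∀ {X} → copy ⨾ (copy ⊛₁ id) ≈ copy {X} ⨾ (id ⊛₁ copy) ⨾ α⁻¹
    copy-unitˡ : ∀ {X} → copy ⨾ (disc ⊛₁ id) ≈ λu⁻¹ {X}
    copy-unitʳ : ∀ {X} → copy ⨾ (id ⊛₁ disc) ≈ ρu⁻¹ {X}
    copy-comm  : ∀ {X} → copy {X} ⨾ σ ≈ copy
    copy-⊛     : ∀ {X Y} → copy {X ⊛ Y} ≈ (copy ⊛₁ copy) ⨾ interchange
    disc-⊛     : ∀ {X Y} → disc {X ⊛ Y} ≈ (disc ⊛₁ disc) ⨾ λu
    copy-I     : copy {I} ≈ λu⁻¹
    disc-I     : disc {I} ≈ id

record FP {o ℓ e} {C : Category o ℓ e} (S : SymMonoidal C) : Set (o ⊔ ℓ ⊔ e) where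
  open Category C
  open SymMonoidal S
  field
    cd : CD S
  open CD cd public
  field
    copy-nat : ∀ {X Y} {f : X ⇒ Y} → f ⨾ copy ≈ copy ⨾ (f ⊛₁ f)
    disc-nat : ∀ {X Y} {f : X ⇒ Y} → f ⨾ disc ≈ disc

record Rig {o ℓ e} (C : Category o ℓ e) : Set (o ⊔ ℓ ⊔ e) where
  open Category C
  field
    plus  : SymMonoidal C
    times : SymMonoidal C
  open SymMonoidal plus public using () renaming
    ( _⊛_ to _⊕_ ; _⊛₁_ to _⊕₁_ ; I to 𝟘 ; α to α⊕ ; α⁻¹ to α⊕⁻¹
    ; λu to λ⊕ ; λu⁻¹ to λ⊕⁻¹ ; ρu to ρ⊕ ; ρu⁻¹ to ρ⊕⁻¹ ; σ to σ⊕ )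
  open SymMonoidal times public using () renaming
    ( _⊛_ to _⊗_ ; _⊛₁_ to _⊗₁_ ; I to 𝟙 ; α to α⊗ ; α⁻¹ to α⊗⁻¹
    ; λu to λ⊗ ; λu⁻¹ to λ⊗⁻¹ ; ρu to ρ⊗ ; ρu⁻¹ to ρ⊗⁻¹ ; σ to σ⊗ )
  field
    δl   : ∀ {A B C} → (A ⊗ (B ⊕ C)) ⇒ ((A ⊗ B) ⊕ (A ⊗ C))
    δl⁻¹ : ∀ {A B C} → ((A ⊗ B) ⊕ (A ⊗ C)) ⇒ (A ⊗ (B ⊕ C))
    δr   : ∀ {A B C} → ((A ⊕ B) ⊗ C) ⇒ ((A ⊗ C) ⊕ (B ⊗ C))
    δr⁻¹ : ∀ {A B C} → ((A ⊗ C) ⊕ (B ⊗ C)) ⇒ ((A ⊕ B) ⊗ C)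
    λ•   : ∀ {A} → (𝟘 ⊗ A) ⇒ 𝟘
    λ•⁻¹ : ∀ {A} → 𝟘 ⇒ (𝟘 ⊗ A)
    ρ•   : ∀ {A} → (A ⊗ 𝟘) ⇒ 𝟘
    ρ•⁻¹ : ∀ {A} → 𝟘 ⇒ (A ⊗ 𝟘)
    δl-iso : ∀ {A B C} → Inverse (δl {A} {B} {C}) δl⁻¹
    δr-iso : ∀ {A B C} → Inverse (δr {A} {B} {C}) δr⁻¹
    λ•-iso : ∀ {A} → Inverse (λ• {A}) λ•⁻¹
    ρ•-iso : ∀ {A} → Inverse (ρ• {A}) ρ•⁻¹
    δl-nat : ∀ {A A′ B B′ C C′} {f : A ⇒ A′} {g : B ⇒ B′} {h : C ⇒ C′}
             → (f ⊗₁ (g ⊕₁ h)) ⨾ δl ≈ δl ⨾ ((f ⊗₁ g) ⊕₁ (f ⊗₁ h))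
    δr-nat : ∀ {A A′ B B′ C C′} {f : A ⇒ A′} {g : B ⇒ B′} {h : C ⇒ C′}
             → ((f ⊕₁ g) ⊗₁ h) ⨾ δr ≈ δr ⨾ ((f ⊗₁ h) ⊕₁ (g ⊗₁ h))
    λ•-nat : ∀ {A B} {f : A ⇒ B} → (id {𝟘} ⊗₁ f) ⨾ λ• ≈ λ•
    ρ•-nat : ∀ {A B} {f : A ⇒ B} → (f ⊗₁ id {𝟘}) ⨾ ρ• ≈ ρ•
    laplaza-I    : ∀ {A B C} → (id {A} ⊗₁ σ⊕ {B} {C}) ⨾ δl ≈ δl ⨾ σ⊕
    laplaza-II   : ∀ {A B C} → δr {A} {B} {C} ≈ σ⊗ ⨾ δl ⨾ (σ⊗ ⊕₁ σ⊗)
    laplaza-III  : ∀ {A B C} → (σ⊕ {A} {B} ⊗₁ id {C}) ⨾ δr ≈ δr ⨾ σ⊕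
    laplaza-IV   : ∀ {A B C D} → (id {A} ⊗₁ α⊕ {B} {C} {D}) ⨾ δl ⨾ (id ⊕₁ δl) ≈ δl ⨾ (δl ⊕₁ id) ⨾ α⊕
    laplaza-V    : ∀ {A B C D} → (α⊕ {A} {B} {C} ⊗₁ id {D}) ⨾ δr ⨾ (id ⊕₁ δr) ≈ δr ⨾ (δr ⊕₁ id) ⨾ α⊕
    laplaza-VI   : ∀ {A B C D} → α⊗ ⨾ (id ⊗₁ δl) ⨾ δl ≈ δl {A ⊗ B} {C} {D} ⨾ (α⊗ ⊕₁ α⊗)
    laplaza-VII  : ∀ {A B C D} → (δl {A} {B} {C} ⊗₁ id {D}) ⨾ δr ⨾ (α⊗ ⊕₁ α⊗) ≈ α⊗ ⨾ (id ⊗₁ δr) ⨾ δl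
    laplaza-VIII : ∀ {A B C D} → (δr {A} {B} {C} ⊗₁ id {D}) ⨾ δr ⨾ (α⊗ ⊕₁ α⊗) ≈ α⊗ ⨾ δr
    laplaza-IX   : ∀ {A B C D} → δr {A} {B} {C ⊕ D} ⨾ (δl ⊕₁ δl)
                   ≈ δl ⨾ (δr ⊕₁ δr) ⨾ α⊕ ⨾ (id ⊕₁ (α⊕⁻¹ ⨾ (σ⊕ ⊕₁ id) ⨾ α⊕)) ⨾ α⊕⁻¹
    laplaza-X    : λ• {𝟘} ≈ ρ• {𝟘}
    laplaza-XI   : ∀ {A B} → α⊗ ⨾ λ• {A ⊗ B} ≈ (λ• {A} ⊗₁ id {B}) ⨾ λ•
    laplaza-XII  : ∀ {A B} → (ρ• {A} ⊗₁ id {B}) ⨾ λ• ≈ α⊗ ⨾ (id ⊗₁ λ•) ⨾ ρ•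
    laplaza-XIII : ∀ {A B} → ρ• {A ⊗ B} ≈ α⊗ ⨾ (id ⊗₁ ρ•) ⨾ ρ•
    laplaza-XIV  : ∀ {A B} → λ• {A ⊕ B} ≈ δl ⨾ (λ• ⊕₁ λ•) ⨾ λ⊕
    laplaza-XV   : ∀ {A B} → ρ• {A ⊕ B} ≈ δr ⨾ (ρ• ⊕₁ ρ•) ⨾ λ⊕
    laplaza-XVI  : λ• {𝟙} ≈ ρ⊗
    laplaza-XVII : ρ• {𝟙} ≈ λ⊗
    laplaza-XVIII : ∀ {A} → ρ• {A} ≈ σ⊗ ⨾ λ•
    laplaza-XIX  : ∀ {A B} → id {A} ⊗₁ λ⊕ {B} ≈ δl ⨾ (ρ• ⊕₁ id) ⨾ λ⊕
    laplaza-XX   : ∀ {A B} → λ⊕ {A} ⊗₁ id {B} ≈ δr ⨾ (λ• ⊕₁ id) ⨾ λ⊕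
    laplaza-XXI  : ∀ {A B} → id {A} ⊗₁ ρ⊕ {B} ≈ δl ⨾ (id ⊕₁ ρ•) ⨾ ρ⊕
    laplaza-XXII : ∀ {A B} → ρ⊕ {A} ⊗₁ id {B} ≈ δr ⨾ (id ⊕₁ λ•) ⨾ ρ⊕
    laplaza-XXIII : ∀ {A B} → λ⊗ {A ⊕ B} ≈ δl ⨾ (λ⊗ ⊕₁ λ⊗)
    laplaza-XXIV : ∀ {A B} → ρ⊗ {A ⊕ B} ≈ δr ⨾ (ρ⊗ ⊕₁ ρ⊗)

record IsFcCdRig {o ℓ e} {C : Category o ℓ e} (R : Rig C)
                 (fc : FC (Rig.plus R)) (cd : CD (Rig.times R)) : Set (o ⊔ ℓ ⊔ e) where
  open Category C
  open Rig R
  open FC fc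
  open CD cd
  field
    disc-⊕ : ∀ {X Y} → disc {X ⊕ Y} ≈ (disc ⊕₁ disc) ⨾ ∇ {𝟙}
    copy-⊕ : ∀ {X Y} → copy {X ⊕ Y}
             ≈ (ρ⊕⁻¹ {X} ⊕₁ λ⊕⁻¹ {Y})
               ⨾ ((copy {X} ⊕₁ ¡ {X ⊗ Y}) ⊕₁ (¡ {Y ⊗ X} ⊕₁ copy {Y}))
               ⨾ (δl⁻¹ {X} {X} {Y} ⊕₁ δl⁻¹ {Y} {X} {Y})
               ⨾ δr⁻¹ {X} {Y} {X ⊕ Y}

record FcFpRig {o ℓ e} (C : Category o ℓ e) : Set (o ⊔ ℓ ⊔ e) where
  field
    rig : Rig C
    fc  : FC (Rig.plus rig)
    fp  : FP (Rig.times rig)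

-- In an fc category ⊕ is a coproduct and 0 is initial, so two maps out of X ⊕ Y agree as soon as
-- they agree on the injections ι₁ and ι₂; in an fp category 1 is terminal. The discard equation is
-- then immediate, and for copy both sides restrict along ι₁ to copy ⨾ (ι₁ ⊗₁ ι₁) (and dually for ι₂):
-- for copy {X ⊕ Y} by naturality of copy, for the prescribed composite because the distributors
-- carry the injections of a sum to the injections (id ⊗₁ ιᵢ), (ιᵢ ⊗₁ id), which follows from
-- Laplaza's unit axioms XIX–XXII together with initiality of 0.
module Submission where

open import Defs
open import Data.Product using (_,_; proj₁; proj₂; swap)
open import Relation.Binary using (Setoid; IsEquivalence)
import Relation.Binary.Reasoning.Setoid as SetoidReasoning

module CategoryProperties {o ℓ e} (C : Category o ℓ e) where
  open Category C

  open module HomEquivalence {A B} = IsEquivalence (≈-equiv {A} {B}) public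
    using () renaming (refl to ≈-refl; sym to ≈-sym; trans to ≈-trans)

  hom-setoid : Obj → Obj → Setoid ℓ e
  hom-setoid A B = record { Carrier = A ⇒ B ; _≈_ = _≈_ ; isEquivalence = ≈-equiv }

  module HomReasoning {A B} = SetoidReasoning (hom-setoid A B)

  infixr 4 refl⟩⨾⟨_
  infixl 5 _⟩⨾⟨refl

  refl⟩⨾⟨_ : ∀ {A B D} {f : A ⇒ B} {g g′ : B ⇒ D} → g ≈ g′ → f ⨾ g ≈ f ⨾ g′
  refl⟩⨾⟨ p = ⨾-cong ≈-refl p

  _⟩⨾⟨refl : ∀ {A B D} {f f′ : A ⇒ B} {g : B ⇒ D} → f ≈ f′ → f ⨾ g ≈ f′ ⨾ g
  p ⟩⨾⟨refl = ⨾-cong p ≈-refl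

  id-comm : ∀ {A B} {f : A ⇒ B} → f ⨾ id ≈ id ⨾ f
  id-comm = ≈-trans identityʳ (≈-sym identityˡ)

  pullˡ : ∀ {A B D E} {f : A ⇒ B} {g : B ⇒ D} {h : A ⇒ D} {r : D ⇒ E}
        → f ⨾ g ≈ h → f ⨾ g ⨾ r ≈ h ⨾ r
  pullˡ p = ≈-trans (≈-sym assoc) (p ⟩⨾⟨refl)

  extendˡ : ∀ {A B B′ D E} {f : A ⇒ B} {g : B ⇒ D} {h : A ⇒ B′} {k : B′ ⇒ D} {r : D ⇒ E}
          → f ⨾ g ≈ h ⨾ k → f ⨾ g ⨾ r ≈ h ⨾ k ⨾ r
  extendˡ p = ≈-trans (pullˡ p) assoc

  cancelˡ : ∀ {A B D} {f : A ⇒ B} {g : B ⇒ A} {h : A ⇒ D} → Inverse f g → f ⨾ g ⨾ h ≈ h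
  cancelˡ iso = ≈-trans (pullˡ (proj₁ iso)) identityˡ

  id-Inverse : ∀ {A} → Inverse (id {A}) id
  id-Inverse = identityˡ , identityˡ

  move-inverseʳ : ∀ {A B D} {h : A ⇒ D} {g : A ⇒ B} {r : B ⇒ D} {r⁻¹ : D ⇒ B}
                → Inverse r r⁻¹ → h ≈ g ⨾ r → h ⨾ r⁻¹ ≈ g
  move-inverseʳ iso p = ≈-trans (p ⟩⨾⟨refl) (≈-trans assoc (≈-trans (refl⟩⨾⟨ proj₁ iso) identityʳ))

  paste : ∀ {A B D E F G} {a : A ⇒ B} {k : B ⇒ D} {h : A ⇒ E} {b : E ⇒ D}
            {k′ : D ⇒ F} {h′ : E ⇒ G} {c : G ⇒ F}
        → a ⨾ k ≈ h ⨾ b → b ⨾ k′ ≈ h′ ⨾ c → a ⨾ (k ⨾ k′) ≈ (h ⨾ h′) ⨾ c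
  paste {a = a} {k} {h} {b} {k′} {h′} {c} p q = begin
    a ⨾ k ⨾ k′       ≈⟨ extendˡ p ⟩
    h ⨾ b ⨾ k′       ≈⟨ refl⟩⨾⟨ q ⟩
    h ⨾ h′ ⨾ c       ≈⟨ ≈-sym assoc ⟩
    (h ⨾ h′) ⨾ c     ∎
    where open HomReasoning

  inverse-square : ∀ {A B A′ B′} {a : A ⇒ B} {k : B ⇒ B′} {h : A ⇒ A′} {b : A′ ⇒ B′}
                     {h⁻¹ : A′ ⇒ A} {k⁻¹ : B′ ⇒ B}
                 → Inverse h h⁻¹ → Inverse k k⁻¹ → a ⨾ k ≈ h ⨾ b → h⁻¹ ⨾ a ≈ b ⨾ k⁻¹
  inverse-square {a = a} {k} {h} {b} {h⁻¹} {k⁻¹} h-iso k-iso p = begin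
    h⁻¹ ⨾ a               ≈⟨ ≈-sym (move-inverseʳ k-iso (≈-sym assoc)) ⟩
    (h⁻¹ ⨾ a ⨾ k) ⨾ k⁻¹   ≈⟨ (refl⟩⨾⟨ p) ⟩⨾⟨refl ⟩
    (h⁻¹ ⨾ h ⨾ b) ⨾ k⁻¹   ≈⟨ cancelˡ (swap h-iso) ⟩⨾⟨refl ⟩
    b ⨾ k⁻¹               ∎
    where open HomReasoning

module SymMonoidalProperties {o ℓ e} {C : Category o ℓ e} (S : SymMonoidal C) where
  open Category C
  open CategoryProperties C
  open SymMonoidal S

  ⊛-Inverse : ∀ {A A′ B B′} {f : A ⇒ A′} {f⁻¹ : A′ ⇒ A} {g : B ⇒ B′} {g⁻¹ : B′ ⇒ B}
            → Inverse f f⁻¹ → Inverse g g⁻¹ → Inverse (f ⊛₁ g) (f⁻¹ ⊛₁ g⁻¹)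
  ⊛-Inverse (ff⁻¹ , f⁻¹f) (gg⁻¹ , g⁻¹g) =
    ≈-trans (≈-sym ⊛-⨾) (≈-trans (⊛-cong ff⁻¹ gg⁻¹) ⊛-id) ,
    ≈-trans (≈-sym ⊛-⨾) (≈-trans (⊛-cong f⁻¹f g⁻¹g) ⊛-id)

  ⊛-square : ∀ {A B D E A′ B′ D′ E′}
               {a : A ⇒ B} {k : B ⇒ D} {h : A ⇒ E} {b : E ⇒ D}
               {a′ : A′ ⇒ B′} {k′ : B′ ⇒ D′} {h′ : A′ ⇒ E′} {b′ : E′ ⇒ D′}
           → a ⨾ k ≈ h ⨾ b → a′ ⨾ k′ ≈ h′ ⨾ b′
           → (a ⊛₁ a′) ⨾ (k ⊛₁ k′) ≈ (h ⊛₁ h′) ⨾ (b ⊛₁ b′)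
  ⊛-square p q = ≈-trans (≈-sym ⊛-⨾) (≈-trans (⊛-cong p q) ⊛-⨾)

  ⊛-⨾-⨾ : ∀ {A B D A′ B′ D′ E} {f : A ⇒ B} {h : B ⇒ D} {g : A′ ⇒ B′} {k : B′ ⇒ D′}
            {r : (D ⊛ D′) ⇒ E}
        → (f ⊛₁ g) ⨾ (h ⊛₁ k) ⨾ r ≈ ((f ⨾ h) ⊛₁ (g ⨾ k)) ⨾ r
  ⊛-⨾-⨾ = pullˡ (≈-sym ⊛-⨾)

  id⊛-⨾ : ∀ {A B D E} {f : B ⇒ D} {g : D ⇒ E} → id {A} ⊛₁ (f ⨾ g) ≈ (id ⊛₁ f) ⨾ (id ⊛₁ g)
  id⊛-⨾ = ≈-trans (⊛-cong (≈-sym identityˡ) ≈-refl) ⊛-⨾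

  ⨾-⊛id : ∀ {A B D E} {f : B ⇒ D} {g : D ⇒ E} → (f ⨾ g) ⊛₁ id {A} ≈ (f ⊛₁ id) ⨾ (g ⊛₁ id)
  ⨾-⊛id = ≈-trans (⊛-cong ≈-refl (≈-sym identityˡ)) ⊛-⨾

  id⊛-⨾-⊛id : ∀ {A A′ B B′} {f : A ⇒ A′} {g : B ⇒ B′} → (id ⊛₁ g) ⨾ (f ⊛₁ id) ≈ f ⊛₁ g
  id⊛-⨾-⊛id = ≈-trans (≈-sym ⊛-⨾) (⊛-cong identityˡ identityʳ)

  ρu⁻¹-nat : ∀ {A B} {f : A ⇒ B} → ρu⁻¹ ⨾ (f ⊛₁ id) ≈ f ⨾ ρu⁻¹
  ρu⁻¹-nat = inverse-square ρu-iso ρu-iso ρu-nat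

  λu⁻¹-nat : ∀ {A B} {f : A ⇒ B} → λu⁻¹ ⨾ (id ⊛₁ f) ≈ f ⨾ λu⁻¹
  λu⁻¹-nat = inverse-square λu-iso λu-iso λu-nat

  α⁻¹-nat : ∀ {A A′ B B′ D D′} {f : A ⇒ A′} {g : B ⇒ B′} {h : D ⇒ D′}
          → (f ⊛₁ (g ⊛₁ h)) ⨾ α⁻¹ ≈ α⁻¹ ⨾ ((f ⊛₁ g) ⊛₁ h)
  α⁻¹-nat = ≈-sym (inverse-square α-iso α-iso α-nat)

  interchange-nat : ∀ {A A′ B B′ D D′ E E′}
                      {f : A ⇒ A′} {g : B ⇒ B′} {h : D ⇒ D′} {k : E ⇒ E′}
                  → ((f ⊛₁ g) ⊛₁ (h ⊛₁ k)) ⨾ interchange ≈ interchange ⨾ ((f ⊛₁ h) ⊛₁ (g ⊛₁ k))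
  interchange-nat = paste α-nat (paste (⊛-square id-comm middle-nat) α⁻¹-nat)
    where
    middle-nat : ∀ {A A′ B B′ D D′} {f : A ⇒ A′} {g : B ⇒ B′} {h : D ⇒ D′}
               → (f ⊛₁ (g ⊛₁ h)) ⨾ (α⁻¹ ⨾ (σ ⊛₁ id) ⨾ α) ≈ (α⁻¹ ⨾ (σ ⊛₁ id) ⨾ α) ⨾ (g ⊛₁ (f ⊛₁ h))
    middle-nat = paste α⁻¹-nat (paste (⊛-square σ-nat id-comm) α-nat)

module FCProperties {o ℓ e} {C : Category o ℓ e} (S : SymMonoidal C) (fc : FC S) where
  open Category C
  open CategoryProperties C
  open SymMonoidal S
  open SymMonoidalProperties S
  open FC fc

  ¡-unique : ∀ {X} {f : I ⇒ X} → f ≈ ¡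
  ¡-unique = ≈-trans (≈-sym identityˡ) (≈-trans (≈-sym ¡-I ⟩⨾⟨refl) ¡-nat)

  I⊛I-initial : ∀ {X} {f g : (I ⊛ I) ⇒ X} → f ≈ g
  I⊛I-initial = ≈-trans (≈-sym (cancelˡ λu-iso))
                  (≈-trans (refl⟩⨾⟨ ≈-trans ¡-unique (≈-sym ¡-unique)) (cancelˡ λu-iso))

  interchange-I : ∀ {A B} → interchange {A} {I} {I} {B} ≈ id
  interchange-I = begin
    α ⨾ (id ⊛₁ (α⁻¹ ⨾ (σ ⊛₁ id) ⨾ α)) ⨾ α⁻¹  ≈⟨ refl⟩⨾⟨ ⊛-cong ≈-refl σ⊛id≈id ⟩⨾⟨refl ⟩
    α ⨾ (id ⊛₁ id) ⨾ α⁻¹                      ≈⟨ refl⟩⨾⟨ ⊛-id ⟩⨾⟨refl ⟩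
    α ⨾ id ⨾ α⁻¹                              ≈⟨ refl⟩⨾⟨ identityˡ ⟩
    α ⨾ α⁻¹                                   ≈⟨ proj₁ α-iso ⟩
    id                                        ∎
    where
    open HomReasoning
    σ⊛id≈id : ∀ {D} → α⁻¹ ⨾ (σ {I} {I} ⊛₁ id {D}) ⨾ α ≈ id
    σ⊛id≈id = ≈-trans (refl⟩⨾⟨ ≈-trans (⊛-cong I⊛I-initial ≈-refl) ⊛-id ⟩⨾⟨refl)
                (≈-trans (refl⟩⨾⟨ identityˡ) (proj₂ α-iso))

  ι₁ : ∀ {A B} → A ⇒ (A ⊛ B)
  ι₁ = ρu⁻¹ ⨾ (id ⊛₁ ¡)

  ι₂ : ∀ {A B} → B ⇒ (A ⊛ B)
  ι₂ = λu⁻¹ ⨾ (¡ ⊛₁ id)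

  via-ι₁ : ∀ {A A′ B} {f : A ⇒ A′} {g : I ⇒ B} → ρu⁻¹ ⨾ (f ⊛₁ g) ≈ f ⨾ ι₁
  via-ι₁ {f = f} {g} = begin
    ρu⁻¹ ⨾ (f ⊛₁ g)                 ≈⟨ refl⟩⨾⟨ ⊛-cong (≈-sym identityʳ) (≈-trans ¡-unique (≈-sym identityˡ)) ⟩
    ρu⁻¹ ⨾ ((f ⨾ id) ⊛₁ (id ⨾ ¡))   ≈⟨ refl⟩⨾⟨ ⊛-⨾ ⟩
    ρu⁻¹ ⨾ (f ⊛₁ id) ⨾ (id ⊛₁ ¡)    ≈⟨ extendˡ ρu⁻¹-nat ⟩
    f ⨾ ι₁                          ∎
    where open HomReasoning

  via-ι₂ : ∀ {A B B′} {f : I ⇒ A} {g : B ⇒ B′} → λu⁻¹ ⨾ (f ⊛₁ g) ≈ g ⨾ ι₂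
  via-ι₂ {f = f} {g} = begin
    λu⁻¹ ⨾ (f ⊛₁ g)                 ≈⟨ refl⟩⨾⟨ ⊛-cong (≈-trans ¡-unique (≈-sym identityˡ)) (≈-sym identityʳ) ⟩
    λu⁻¹ ⨾ ((id ⨾ ¡) ⊛₁ (g ⨾ id))   ≈⟨ refl⟩⨾⟨ ⊛-⨾ ⟩
    λu⁻¹ ⨾ (id ⊛₁ g) ⨾ (¡ ⊛₁ id)    ≈⟨ extendˡ λu⁻¹-nat ⟩
    g ⨾ ι₂                          ∎
    where open HomReasoning

  ι₁-nat : ∀ {A A′ B B′} {f : A ⇒ A′} {g : B ⇒ B′} → ι₁ ⨾ (f ⊛₁ g) ≈ f ⨾ ι₁
  ι₁-nat = ≈-trans assoc (≈-trans (refl⟩⨾⟨ ≈-trans (≈-sym ⊛-⨾) (⊛-cong identityˡ ≈-refl)) via-ι₁)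

  ι₂-nat : ∀ {A A′ B B′} {f : A ⇒ A′} {g : B ⇒ B′} → ι₂ ⨾ (f ⊛₁ g) ≈ g ⨾ ι₂
  ι₂-nat = ≈-trans assoc (≈-trans (refl⟩⨾⟨ ≈-trans (≈-sym ⊛-⨾) (⊛-cong ≈-refl identityˡ)) via-ι₂)

  copair-ι : ∀ {A B} → (ι₁ ⊛₁ ι₂) ⨾ ∇ {A ⊛ B} ≈ id
  copair-ι = begin
    (ι₁ ⊛₁ ι₂) ⨾ ∇                                                      ≈⟨ ⨾-cong ⊛-⨾ ∇-⊛ ⟩
    ((ρu⁻¹ ⊛₁ λu⁻¹) ⨾ ((id ⊛₁ ¡) ⊛₁ (¡ ⊛₁ id))) ⨾ interchange ⨾ (∇ ⊛₁ ∇) ≈⟨ assoc ⟩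
    (ρu⁻¹ ⊛₁ λu⁻¹) ⨾ ((id ⊛₁ ¡) ⊛₁ (¡ ⊛₁ id)) ⨾ interchange ⨾ (∇ ⊛₁ ∇)   ≈⟨ refl⟩⨾⟨ extendˡ interchange-nat ⟩
    (ρu⁻¹ ⊛₁ λu⁻¹) ⨾ interchange ⨾ ((id ⊛₁ ¡) ⊛₁ (¡ ⊛₁ id)) ⨾ (∇ ⊛₁ ∇)   ≈⟨ refl⟩⨾⟨ interchange-I ⟩⨾⟨refl ⟩
    (ρu⁻¹ ⊛₁ λu⁻¹) ⨾ id ⨾ ((id ⊛₁ ¡) ⊛₁ (¡ ⊛₁ id)) ⨾ (∇ ⊛₁ ∇)            ≈⟨ refl⟩⨾⟨ identityˡ ⟩
    (ρu⁻¹ ⊛₁ λu⁻¹) ⨾ ((id ⊛₁ ¡) ⊛₁ (¡ ⊛₁ id)) ⨾ (∇ ⊛₁ ∇)                 ≈⟨ refl⟩⨾⟨ ≈-sym ⊛-⨾ ⟩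
    (ρu⁻¹ ⊛₁ λu⁻¹) ⨾ (((id ⊛₁ ¡) ⨾ ∇) ⊛₁ ((¡ ⊛₁ id) ⨾ ∇))               ≈⟨ refl⟩⨾⟨ ⊛-cong ∇-unitʳ ∇-unitˡ ⟩
    (ρu⁻¹ ⊛₁ λu⁻¹) ⨾ (ρu ⊛₁ λu)                                         ≈⟨ proj₁ (⊛-Inverse (swap ρu-iso) (swap λu-iso)) ⟩
    id                                                                  ∎
    where open HomReasoning

  copair-η : ∀ {A B X} (f : (A ⊛ B) ⇒ X) → f ≈ ((ι₁ ⨾ f) ⊛₁ (ι₂ ⨾ f)) ⨾ ∇
  copair-η f = begin
    f                            ≈⟨ ≈-sym identityˡ ⟩
    id ⨾ f                       ≈⟨ ≈-sym copair-ι ⟩⨾⟨refl ⟩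
    ((ι₁ ⊛₁ ι₂) ⨾ ∇) ⨾ f         ≈⟨ assoc ⟩
    (ι₁ ⊛₁ ι₂) ⨾ ∇ ⨾ f           ≈⟨ refl⟩⨾⟨ ≈-sym ∇-nat ⟩
    (ι₁ ⊛₁ ι₂) ⨾ (f ⊛₁ f) ⨾ ∇    ≈⟨ ⊛-⨾-⨾ ⟩
    ((ι₁ ⨾ f) ⊛₁ (ι₂ ⨾ f)) ⨾ ∇   ∎
    where open HomReasoning

  coproduct-ext : ∀ {A B X} {f g : (A ⊛ B) ⇒ X} → ι₁ ⨾ f ≈ ι₁ ⨾ g → ι₂ ⨾ f ≈ ι₂ ⨾ g → f ≈ g
  coproduct-ext {f = f} {g} p q =
    ≈-trans (copair-η f) (≈-trans (⊛-cong p q ⟩⨾⟨refl) (≈-sym (copair-η g)))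

module FPProperties {o ℓ e} {C : Category o ℓ e} (S : SymMonoidal C) (fp : FP S) where
  open Category C
  open CategoryProperties C
  open SymMonoidal S
  open FP fp

  disc-unique : ∀ {X} {f : X ⇒ I} → f ≈ disc
  disc-unique = ≈-trans (≈-sym identityʳ) (≈-trans (refl⟩⨾⟨ ≈-sym disc-I) disc-nat)

module DistributorInjections {o ℓ e} {C : Category o ℓ e} (R : Rig C) (fc : FC (Rig.plus R)) where
  open Category C
  open CategoryProperties C
  open Rig R
  open FC fc using (¡)
  open FCProperties plus fc
  private
    module P = SymMonoidal plus
    module T = SymMonoidal times
    module P′ = SymMonoidalProperties plus
    module T′ = SymMonoidalProperties times

  δl-ρ⊕⁻¹ : ∀ {A B} → (id {A} ⊗₁ ρ⊕⁻¹ {B}) ⨾ δl ≈ ρ⊕⁻¹ ⨾ (id ⊕₁ ρ•⁻¹)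
  δl-ρ⊕⁻¹ = inverse-square (T′.⊛-Inverse id-Inverse P.ρu-iso) (P′.⊛-Inverse id-Inverse ρ•-iso)
              (≈-sym (move-inverseʳ P.ρu-iso (≈-trans laplaza-XXI (≈-sym assoc))))

  δl-λ⊕⁻¹ : ∀ {A B} → (id {A} ⊗₁ λ⊕⁻¹ {B}) ⨾ δl ≈ λ⊕⁻¹ ⨾ (ρ•⁻¹ ⊕₁ id)
  δl-λ⊕⁻¹ = inverse-square (T′.⊛-Inverse id-Inverse P.λu-iso) (P′.⊛-Inverse ρ•-iso id-Inverse)
              (≈-sym (move-inverseʳ P.λu-iso (≈-trans laplaza-XIX (≈-sym assoc))))

  δr-ρ⊕⁻¹ : ∀ {A B} → (ρ⊕⁻¹ {A} ⊗₁ id {B}) ⨾ δr ≈ ρ⊕⁻¹ ⨾ (id ⊕₁ λ•⁻¹)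
  δr-ρ⊕⁻¹ = inverse-square (T′.⊛-Inverse P.ρu-iso id-Inverse) (P′.⊛-Inverse id-Inverse λ•-iso)
              (≈-sym (move-inverseʳ P.ρu-iso (≈-trans laplaza-XXII (≈-sym assoc))))

  δr-λ⊕⁻¹ : ∀ {A B} → (λ⊕⁻¹ {A} ⊗₁ id {B}) ⨾ δr ≈ λ⊕⁻¹ ⨾ (λ•⁻¹ ⊕₁ id)
  δr-λ⊕⁻¹ = inverse-square (T′.⊛-Inverse P.λu-iso id-Inverse) (P′.⊛-Inverse λ•-iso id-Inverse)
              (≈-sym (move-inverseʳ P.λu-iso (≈-trans laplaza-XX (≈-sym assoc))))

  δl⁻¹-ι₁ : ∀ {A B D} → ι₁ ⨾ δl⁻¹ ≈ id {A} ⊗₁ ι₁ {B} {D}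
  δl⁻¹-ι₁ = move-inverseʳ δl-iso (≈-sym δl-ι₁)
    where
    open HomReasoning
    δl-ι₁ : ∀ {A B D} → (id {A} ⊗₁ ι₁ {B} {D}) ⨾ δl ≈ ι₁
    δl-ι₁ = begin
      (id ⊗₁ (ρ⊕⁻¹ ⨾ (id ⊕₁ ¡))) ⨾ δl                   ≈⟨ T′.id⊛-⨾ ⟩⨾⟨refl ⟩
      ((id ⊗₁ ρ⊕⁻¹) ⨾ (id ⊗₁ (id ⊕₁ ¡))) ⨾ δl            ≈⟨ assoc ⟩
      (id ⊗₁ ρ⊕⁻¹) ⨾ (id ⊗₁ (id ⊕₁ ¡)) ⨾ δl              ≈⟨ refl⟩⨾⟨ δl-nat ⟩
      (id ⊗₁ ρ⊕⁻¹) ⨾ δl ⨾ ((id ⊗₁ id) ⊕₁ (id ⊗₁ ¡))      ≈⟨ extendˡ δl-ρ⊕⁻¹ ⟩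
      ρ⊕⁻¹ ⨾ (id ⊕₁ ρ•⁻¹) ⨾ ((id ⊗₁ id) ⊕₁ (id ⊗₁ ¡))    ≈⟨ refl⟩⨾⟨ ≈-sym P.⊛-⨾ ⟩
      ρ⊕⁻¹ ⨾ ((id ⨾ (id ⊗₁ id)) ⊕₁ (ρ•⁻¹ ⨾ (id ⊗₁ ¡)))    ≈⟨ via-ι₁ ⟩
      (id ⨾ (id ⊗₁ id)) ⨾ ι₁                            ≈⟨ ≈-trans (≈-trans identityˡ T.⊛-id ⟩⨾⟨refl) identityˡ ⟩
      ι₁                                                ∎

  δl⁻¹-ι₂ : ∀ {A B D} → ι₂ ⨾ δl⁻¹ ≈ id {A} ⊗₁ ι₂ {B} {D}
  δl⁻¹-ι₂ = move-inverseʳ δl-iso (≈-sym δl-ι₂)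
    where
    open HomReasoning
    δl-ι₂ : ∀ {A B D} → (id {A} ⊗₁ ι₂ {B} {D}) ⨾ δl ≈ ι₂
    δl-ι₂ = begin
      (id ⊗₁ (λ⊕⁻¹ ⨾ (¡ ⊕₁ id))) ⨾ δl                   ≈⟨ T′.id⊛-⨾ ⟩⨾⟨refl ⟩
      ((id ⊗₁ λ⊕⁻¹) ⨾ (id ⊗₁ (¡ ⊕₁ id))) ⨾ δl            ≈⟨ assoc ⟩
      (id ⊗₁ λ⊕⁻¹) ⨾ (id ⊗₁ (¡ ⊕₁ id)) ⨾ δl              ≈⟨ refl⟩⨾⟨ δl-nat ⟩
      (id ⊗₁ λ⊕⁻¹) ⨾ δl ⨾ ((id ⊗₁ ¡) ⊕₁ (id ⊗₁ id))      ≈⟨ extendˡ δl-λ⊕⁻¹ ⟩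
      λ⊕⁻¹ ⨾ (ρ•⁻¹ ⊕₁ id) ⨾ ((id ⊗₁ ¡) ⊕₁ (id ⊗₁ id))    ≈⟨ refl⟩⨾⟨ ≈-sym P.⊛-⨾ ⟩
      λ⊕⁻¹ ⨾ ((ρ•⁻¹ ⨾ (id ⊗₁ ¡)) ⊕₁ (id ⨾ (id ⊗₁ id)))    ≈⟨ via-ι₂ ⟩
      (id ⨾ (id ⊗₁ id)) ⨾ ι₂                            ≈⟨ ≈-trans (≈-trans identityˡ T.⊛-id ⟩⨾⟨refl) identityˡ ⟩
      ι₂                                                ∎

  δr⁻¹-ι₁ : ∀ {A B D} → ι₁ ⨾ δr⁻¹ ≈ ι₁ {A} {B} ⊗₁ id {D}
  δr⁻¹-ι₁ = move-inverseʳ δr-iso (≈-sym δr-ι₁)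
    where
    open HomReasoning
    δr-ι₁ : ∀ {A B D} → (ι₁ {A} {B} ⊗₁ id {D}) ⨾ δr ≈ ι₁
    δr-ι₁ = begin
      ((ρ⊕⁻¹ ⨾ (id ⊕₁ ¡)) ⊗₁ id) ⨾ δr                   ≈⟨ T′.⨾-⊛id ⟩⨾⟨refl ⟩
      ((ρ⊕⁻¹ ⊗₁ id) ⨾ ((id ⊕₁ ¡) ⊗₁ id)) ⨾ δr            ≈⟨ assoc ⟩
      (ρ⊕⁻¹ ⊗₁ id) ⨾ ((id ⊕₁ ¡) ⊗₁ id) ⨾ δr              ≈⟨ refl⟩⨾⟨ δr-nat ⟩
      (ρ⊕⁻¹ ⊗₁ id) ⨾ δr ⨾ ((id ⊗₁ id) ⊕₁ (¡ ⊗₁ id))      ≈⟨ extendˡ δr-ρ⊕⁻¹ ⟩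
      ρ⊕⁻¹ ⨾ (id ⊕₁ λ•⁻¹) ⨾ ((id ⊗₁ id) ⊕₁ (¡ ⊗₁ id))    ≈⟨ refl⟩⨾⟨ ≈-sym P.⊛-⨾ ⟩
      ρ⊕⁻¹ ⨾ ((id ⨾ (id ⊗₁ id)) ⊕₁ (λ•⁻¹ ⨾ (¡ ⊗₁ id)))    ≈⟨ via-ι₁ ⟩
      (id ⨾ (id ⊗₁ id)) ⨾ ι₁                            ≈⟨ ≈-trans (≈-trans identityˡ T.⊛-id ⟩⨾⟨refl) identityˡ ⟩
      ι₁                                                ∎

  δr⁻¹-ι₂ : ∀ {A B D} → ι₂ ⨾ δr⁻¹ ≈ ι₂ {A} {B} ⊗₁ id {D}
  δr⁻¹-ι₂ = move-inverseʳ δr-iso (≈-sym δr-ι₂)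
    where
    open HomReasoning
    δr-ι₂ : ∀ {A B D} → (ι₂ {A} {B} ⊗₁ id {D}) ⨾ δr ≈ ι₂
    δr-ι₂ = begin
      ((λ⊕⁻¹ ⨾ (¡ ⊕₁ id)) ⊗₁ id) ⨾ δr                   ≈⟨ T′.⨾-⊛id ⟩⨾⟨refl ⟩
      ((λ⊕⁻¹ ⊗₁ id) ⨾ ((¡ ⊕₁ id) ⊗₁ id)) ⨾ δr            ≈⟨ assoc ⟩
      (λ⊕⁻¹ ⊗₁ id) ⨾ ((¡ ⊕₁ id) ⊗₁ id) ⨾ δr              ≈⟨ refl⟩⨾⟨ δr-nat ⟩
      (λ⊕⁻¹ ⊗₁ id) ⨾ δr ⨾ ((¡ ⊗₁ id) ⊕₁ (id ⊗₁ id))      ≈⟨ extendˡ δr-λ⊕⁻¹ ⟩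
      λ⊕⁻¹ ⨾ (λ•⁻¹ ⊕₁ id) ⨾ ((¡ ⊗₁ id) ⊕₁ (id ⊗₁ id))    ≈⟨ refl⟩⨾⟨ ≈-sym P.⊛-⨾ ⟩
      λ⊕⁻¹ ⨾ ((λ•⁻¹ ⨾ (¡ ⊗₁ id)) ⊕₁ (id ⨾ (id ⊗₁ id)))    ≈⟨ via-ι₂ ⟩
      (id ⨾ (id ⊗₁ id)) ⨾ ι₂                            ≈⟨ ≈-trans (≈-trans identityˡ T.⊛-id ⟩⨾⟨refl) identityˡ ⟩
      ι₂                                                ∎

  ρ⊕⁻¹⨾⊕⨾δl⁻¹ : ∀ {X A B D} {f : X ⇒ (A ⊗ B)} {g : 𝟘 ⇒ (A ⊗ D)}
              → ρ⊕⁻¹ ⨾ (f ⊕₁ g) ⨾ δl⁻¹ ≈ f ⨾ (id ⊗₁ ι₁)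
  ρ⊕⁻¹⨾⊕⨾δl⁻¹ = ≈-trans (pullˡ via-ι₁) (≈-trans assoc (refl⟩⨾⟨ δl⁻¹-ι₁))

  λ⊕⁻¹⨾⊕⨾δl⁻¹ : ∀ {X A B D} {f : 𝟘 ⇒ (A ⊗ B)} {g : X ⇒ (A ⊗ D)}
              → λ⊕⁻¹ ⨾ (f ⊕₁ g) ⨾ δl⁻¹ ≈ g ⨾ (id ⊗₁ ι₂)
  λ⊕⁻¹⨾⊕⨾δl⁻¹ = ≈-trans (pullˡ via-ι₂) (≈-trans assoc (refl⟩⨾⟨ δl⁻¹-ι₂))

  ι₁⨾⊕⨾δr⁻¹ : ∀ {X Y A B D} {f : X ⇒ (A ⊗ D)} {g : Y ⇒ (B ⊗ D)}
            → ι₁ ⨾ (f ⊕₁ g) ⨾ δr⁻¹ ≈ f ⨾ (ι₁ ⊗₁ id)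
  ι₁⨾⊕⨾δr⁻¹ = ≈-trans (pullˡ ι₁-nat) (≈-trans assoc (refl⟩⨾⟨ δr⁻¹-ι₁))

  ι₂⨾⊕⨾δr⁻¹ : ∀ {X Y A B D} {f : X ⇒ (A ⊗ D)} {g : Y ⇒ (B ⊗ D)}
            → ι₂ ⨾ (f ⊕₁ g) ⨾ δr⁻¹ ≈ g ⨾ (ι₂ ⊗₁ id)
  ι₂⨾⊕⨾δr⁻¹ = ≈-trans (pullˡ ι₂-nat) (≈-trans assoc (refl⟩⨾⟨ δr⁻¹-ι₂))

module FcFpRigProperties {o ℓ e} {C : Category o ℓ e} (R : FcFpRig C) where
  open Category C
  open CategoryProperties C
  open FcFpRig R
  open Rig rig
  open FC fc using (∇; ¡)
  open FP fp using (copy; disc; copy-nat)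
  open FCProperties plus fc using (ι₁; ι₂; coproduct-ext)
  open FPProperties times fp using (disc-unique)
  open DistributorInjections rig fc
  module P = SymMonoidal plus
  module P′ = SymMonoidalProperties plus
  module T′ = SymMonoidalProperties times

  disc-⊕ : ∀ {X Y} → disc {X ⊕ Y} ≈ (disc ⊕₁ disc) ⨾ ∇ {𝟙}
  disc-⊕ = ≈-sym disc-unique

  copy-sum : ∀ {X Y} → (X ⊕ Y) ⇒ ((X ⊕ Y) ⊗ (X ⊕ Y))
  copy-sum {X} {Y} = (ρ⊕⁻¹ {X} ⊕₁ λ⊕⁻¹ {Y})
                     ⨾ ((copy {X} ⊕₁ ¡ {X ⊗ Y}) ⊕₁ (¡ {Y ⊗ X} ⊕₁ copy {Y}))
                     ⨾ (δl⁻¹ {X} {X} {Y} ⊕₁ δl⁻¹ {Y} {X} {Y})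
                     ⨾ δr⁻¹ {X} {Y} {X ⊕ Y}

  copy-sum-factor : ∀ {X Y} → copy-sum {X} {Y} ≈ ((copy ⨾ (id ⊗₁ ι₁)) ⊕₁ (copy ⨾ (id ⊗₁ ι₂))) ⨾ δr⁻¹
  copy-sum-factor = ≈-trans (refl⟩⨾⟨ P′.⊛-⨾-⨾)
                      (≈-trans P′.⊛-⨾-⨾ (P.⊛-cong ρ⊕⁻¹⨾⊕⨾δl⁻¹ λ⊕⁻¹⨾⊕⨾δl⁻¹ ⟩⨾⟨refl))

  copy-⊕ : ∀ {X Y} → copy {X ⊕ Y} ≈ copy-sum
  copy-⊕ = coproduct-ext
    (begin
      ι₁ ⨾ copy                                   ≈⟨ copy-nat ⟩
      copy ⨾ (ι₁ ⊗₁ ι₁)                           ≈⟨ refl⟩⨾⟨ ≈-sym T′.id⊛-⨾-⊛id ⟩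
      copy ⨾ (id ⊗₁ ι₁) ⨾ (ι₁ ⊗₁ id)              ≈⟨ ≈-sym assoc ⟩
      (copy ⨾ (id ⊗₁ ι₁)) ⨾ (ι₁ ⊗₁ id)            ≈⟨ ≈-sym ι₁⨾⊕⨾δr⁻¹ ⟩
      ι₁ ⨾ ((copy ⨾ (id ⊗₁ ι₁)) ⊕₁ (copy ⨾ (id ⊗₁ ι₂))) ⨾ δr⁻¹ ≈⟨ refl⟩⨾⟨ ≈-sym copy-sum-factor ⟩
      ι₁ ⨾ copy-sum                               ∎)
    (begin
      ι₂ ⨾ copy                                   ≈⟨ copy-nat ⟩
      copy ⨾ (ι₂ ⊗₁ ι₂)                           ≈⟨ refl⟩⨾⟨ ≈-sym T′.id⊛-⨾-⊛id ⟩
      copy ⨾ (id ⊗₁ ι₂) ⨾ (ι₂ ⊗₁ id)              ≈⟨ ≈-sym assoc ⟩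
      (copy ⨾ (id ⊗₁ ι₂)) ⨾ (ι₂ ⊗₁ id)            ≈⟨ ≈-sym ι₂⨾⊕⨾δr⁻¹ ⟩
      ι₂ ⨾ ((copy ⨾ (id ⊗₁ ι₁)) ⊕₁ (copy ⨾ (id ⊗₁ ι₂))) ⨾ δr⁻¹ ≈⟨ refl⟩⨾⟨ ≈-sym copy-sum-factor ⟩
      ι₂ ⨾ copy-sum                               ∎)
    where open HomReasoning

lemma14 : ∀ {o ℓ e} {C : Category o ℓ e} (R : FcFpRig C)
          → IsFcCdRig (FcFpRig.rig R) (FcFpRig.fc R) (FP.cd (FcFpRig.fp R))
lemma14 R = record { disc-⊕ = disc-⊕ ; copy-⊕ = copy-⊕ }
  where open FcFpRigProperties R
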